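{- Let $F$ and $G$ be forests on the vertex set $\mathcal N=\{1,\dots,N\}$, let $T^F$ be a tree of $F$ and $T^G$ a tree of $G$, let $\mathcal C=\mathcal V T^F\cap\mathcal V T^G$, and let $\mathcal D\subseteq\mathcal C$ be such that $F$ has no arc with origin outside $\mathcal D$ and terminus in $\mathcal D$, and no arc of $F$ with origin in $\mathcal D$ has its terminus in $\mathcal C$. Then the $\mathcal D$-exchange of $F$ by $G$ and the $\mathcal D$-exchange of $G$ by $F$ are forests.
   Context: A forest is a digraph without directed circuits (loops count as circuits) in which every vertex has outdegree $0$ or $1$; its trees are its weakly connected components; $\mathcal V T$ denotes the vertex set of $T$. For digraphs $F,G$ on $\mathcal N$ and $\mathcal D\subseteq\mathcal N$, the $\mathcal D$-exchange of $F$ by $G$ is the digraph on $\mathcal N$ whose arcs are the arcs of $F$ with origin outside $\mathcal D$ together with the arcs of $G$ with origin in $\mathcal D$. -}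

module Defs where

open import Data.Nat using (ℕ; _≤_)
open import Data.Bool using (Bool; true; false; if_then_else_)
open import Data.Fin using (Fin)
open import Data.Fin.Subset using (Subset; _∈_; _∉_)
open import Data.Fin.Subset.Properties using (_∈?_)
open import Data.List using (List; map; allFin)
open import Data.Nat.ListAction using (sum)
open import Data.Product using (_×_)
open import Relation.Nullary using (¬_; does)
open import Relation.Binary.PropositionalEquality using (_≡_)
open import Relation.Binary.Construct.Closure.Transitive using (TransClosure)
open import Relation.Binary.Construct.Closure.Symmetric using (SymClosure)
open import Relation.Binary.Construct.Closure.ReflexiveTransitive using (Star)

-- A (simple) digraph on the vertex set 𝒩 = Fin N, given by its adjacency
-- matrix: G u v = true iff (u , v) is an arc with origin u and terminus v.
Digraph : ℕ → Set
Digraph N = Fin N → Fin N → Bool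

Arc : ∀ {N} → Digraph N → Fin N → Fin N → Set
Arc G u v = G u v ≡ true

outdeg : ∀ {N} → Digraph N → Fin N → ℕ
outdeg {N} G u = sum (map (λ v → if G u v then 1 else 0) (allFin N))

-- a directed circuit through v: a closed directed walk of positive length
-- (a loop is a circuit of length 1)
HasCircuitAt : ∀ {N} → Digraph N → Fin N → Set
HasCircuitAt G v = TransClosure (Arc G) v v

IsForest : ∀ {N} → Digraph N → Set
IsForest {N} G = (∀ (v : Fin N) → ¬ HasCircuitAt G v) × (∀ (u : Fin N) → outdeg G u ≤ 1)

WeaklyConnected : ∀ {N} → Digraph N → Fin N → Fin N → Set
WeaklyConnected G = Star (SymClosure (Arc G))

-- vertex set of the tree (weak component) of G containing r
InTreeOf : ∀ {N} → Digraph N → Fin N → Fin N → Set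
InTreeOf G r v = WeaklyConnected G r v

exchange : ∀ {N} → Subset N → Digraph N → Digraph N → Digraph N
exchange D F G u v = if does (u ∈? D) then G u v else F u v

-- Exchanging F by G on 𝒟 creates no circuit, because F never enters 𝒟 from
-- outside: a circuit through a vertex outside 𝒟 never enters 𝒟, so it is a
-- circuit of F, and a circuit through a vertex of 𝒟 never leaves 𝒟, so it is
-- a circuit of G. In the exchange of G by F, a circuit avoiding 𝒟 is a circuit
-- of G; otherwise it uses an F-arc d → w with d ∈ 𝒟 and returns from w to d.
-- Walking back from d, every vertex stays in T^G (vertices of 𝒟 lie in T^G,
-- the others leave along arcs of G), so w ∈ T^G; and w ∈ T^F as the F-successor
-- of d. Hence w ∈ 𝒞, which the hypotheses on 𝒟 forbid.
module Submission where

open import Defs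
open import Data.Nat using (ℕ; _≤_)
open import Data.Fin using (Fin)
open import Data.Fin.Subset using (Subset; _∈_; _∉_)
open import Data.Fin.Subset.Properties using (_∈?_)
open import Data.Product using (_×_; _,_; proj₁; proj₂; ∃₂)
open import Data.Sum using (_⊎_; inj₁; inj₂)
open import Relation.Nullary using (¬_; yes; no; contradiction)
open import Relation.Binary.Construct.Closure.Transitive using (TransClosure; [_]; _∷_)
open import Relation.Binary.Construct.Closure.Symmetric using (fwd; bwd)
open import Relation.Binary.Construct.Closure.ReflexiveTransitive using (Star; ε; _◅_; _◅◅_)

Acyclic : ∀ {N} → Digraph N → Set
Acyclic {N} G = ∀ (v : Fin N) → ¬ HasCircuitAt G v

trans⇒star : ∀ {N} {G : Digraph N} {x y} → TransClosure (Arc G) x y → Star (Arc G) x y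
trans⇒star [ a ]   = a ◅ ε
trans⇒star (a ∷ p) = a ◅ trans⇒star p

module _ {N : ℕ} (D : Subset N) (F G : Digraph N) where

  private
    H = exchange D F G

  exchange-arc : ∀ {u v} → Arc H u v → (u ∈ D × Arc G u v) ⊎ (u ∉ D × Arc F u v)
  exchange-arc {u} a with u ∈? D
  ... | yes u∈D = inj₁ (u∈D , a)
  ... | no  u∉D = inj₂ (u∉D , a)

  exchange-outdeg≤1 : ∀ u → outdeg F u ≤ 1 → outdeg G u ≤ 1 → outdeg H u ≤ 1
  exchange-outdeg≤1 u degF≤1 degG≤1 with u ∈? D
  ... | yes _ = degG≤1
  ... | no  _ = degF≤1

  module _ (F-stays-outside : ∀ u v → u ∉ D → Arc F u v → v ∉ D) where

    exchange⁺-from-outside : ∀ {x y} → x ∉ D → TransClosure (Arc H) x y → TransClosure (Arc F) x y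
    exchange⁺-from-outside x∉D [ a ] with exchange-arc a
    ... | inj₁ (x∈D , _) = contradiction x∈D x∉D
    ... | inj₂ (_ , b)   = [ b ]
    exchange⁺-from-outside {x} x∉D (_∷_ {y = z} a p) with exchange-arc a
    ... | inj₁ (x∈D , _) = contradiction x∈D x∉D
    ... | inj₂ (_ , b)   = b ∷ exchange⁺-from-outside (F-stays-outside x z x∉D b) p

    exchange⁺-into-inside : ∀ {x y} → y ∈ D → TransClosure (Arc H) x y →
                            x ∈ D × TransClosure (Arc G) x y
    exchange⁺-into-inside {x} {y} y∈D [ a ] with exchange-arc a
    ... | inj₁ (x∈D , b) = x∈D , [ b ]
    ... | inj₂ (x∉D , b) = contradiction y∈D (F-stays-outside x y x∉D b)
    exchange⁺-into-inside {x} y∈D (_∷_ {y = z} a p) with exchange⁺-into-inside y∈D p | exchange-arc a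
    ... | _ , q   | inj₁ (x∈D , b) = x∈D , b ∷ q
    ... | z∈D , _ | inj₂ (x∉D , b) = contradiction z∈D (F-stays-outside x z x∉D b)

    exchange-acyclic : Acyclic F → Acyclic G → Acyclic H
    exchange-acyclic acyclicF acyclicG v c with v ∈? D
    ... | yes v∈D = acyclicG v (proj₂ (exchange⁺-into-inside v∈D c))
    ... | no  v∉D = acyclicF v (exchange⁺-from-outside v∉D c)

  exchange⁺-split : ∀ {x y} → TransClosure (Arc H) x y →
    TransClosure (Arc F) x y ⊎
    ∃₂ λ d w → d ∈ D × Arc G d w × Star (Arc H) x d × Star (Arc H) w y
  exchange⁺-split {x} {y} [ a ] with exchange-arc a
  ... | inj₁ (x∈D , b) = inj₂ (x , y , x∈D , b , ε , ε)
  ... | inj₂ (_ , b)   = inj₁ [ b ]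
  exchange⁺-split {x} (_∷_ {y = z} a p) with exchange-arc a
  ... | inj₁ (x∈D , b) = inj₂ (x , z , x∈D , b , ε , trans⇒star p)
  ... | inj₂ (_ , b) with exchange⁺-split p
  ...   | inj₁ q = inj₁ (b ∷ q)
  ...   | inj₂ (d , w , d∈D , c , x→d , w→y) = inj₂ (d , w , d∈D , c , a ◅ x→d , w→y)

  exchange⋆-reflects-tree : ∀ {r} → (∀ v → v ∈ D → InTreeOf F r v) →
    ∀ {x y} → Star (Arc H) x y → InTreeOf F r y → InTreeOf F r x
  exchange⋆-reflects-tree D⊆T ε y∈T = y∈T
  exchange⋆-reflects-tree D⊆T {x} (a ◅ s) y∈T with exchange-arc a
  ... | inj₁ (x∈D , _) = D⊆T x x∈D
  ... | inj₂ (_ , b)   = exchange⋆-reflects-tree D⊆T s y∈T ◅◅ (bwd b ◅ ε)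

mainTheorem17 : (N : ℕ) (F G : Digraph N) → IsForest F → IsForest G →
    (rF rG : Fin N) (D : Subset N) →
    (∀ v → v ∈ D → InTreeOf F rF v × InTreeOf G rG v) →
    (∀ u v → u ∉ D → Arc F u v → v ∉ D) →
    (∀ u v → u ∈ D → Arc F u v → ¬ (InTreeOf F rF v × InTreeOf G rG v)) →
    IsForest (exchange D F G) × IsForest (exchange D G F)
mainTheorem17 N F G (acyclicF , degF) (acyclicG , degG) rF rG D D⊆C F-stays-outside F-leaves-C =
  (exchange-acyclic D F G F-stays-outside acyclicF acyclicG ,
   λ u → exchange-outdeg≤1 D F G u (degF u) (degG u)) ,
  (acyclicGF , λ u → exchange-outdeg≤1 D G F u (degG u) (degF u))
  where
  acyclicGF : Acyclic (exchange D G F)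
  acyclicGF v c with exchange⁺-split D G F c
  ... | inj₁ q = acyclicG v q
  ... | inj₂ (d , w , d∈D , b , v→d , w→v) =
    F-leaves-C d w d∈D b
      ( proj₁ (D⊆C d d∈D) ◅◅ (fwd b ◅ ε)
      , exchange⋆-reflects-tree D G F (λ u u∈D → proj₂ (D⊆C u u∈D)) (w→v ◅◅ v→d) (proj₂ (D⊆C d d∈D)))
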